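{- Let $\phi$ be a formula as described in the context, with $n$ variables, and let $G$ be the weighted graph constructed from $\phi$. If $G$ has a greedy matching of weight at least $14n+k$, then there exists a truth assignment that satisfies at least $k$ clauses of $\phi$.
   Context: Greedy matching: for a finite simple undirected graph with positive edge weights and distinct weights $w_1>\dots>w_\ell$, a greedy matching is any matching that can be output by: $\mathcal{M}\leftarrow\emptyset$; for $i=1,\dots,\ell$, while the current edge set contains an edge of weight $w_i$, pick any such edge $e^*$, add it to $\mathcal{M}$, and delete all edges sharing an endpoint with $e^*$. The weight of a matching is the sum of its edge weights. Formula: $\phi$ is a CNF formula over variables $x_1,\dots,x_n$ with clauses $C_1,\dots,C_m$ (in this fixed order), each clause having at most 2 literals, and each variable $x_i$ occurring either exactly twice in $\phi$ (once as $x_i$, once as $\overline{x_i}$) or exactly three times (once as $x_i$, twice as $\overline{x_i}$). Construction of $G$: for each variable $x_i$ take a path on the ten vertices $\beta_{x_i},p_{x_i},q_{x_i},r_{x_i},\alpha_{x_i},\gamma_{x_i},y_{x_i},z_{x_i},s_{x_i},t_{x_i}$ (in this order) with consecutive edge weights $1,3,4,4,4,4,4,3,1$. For each clause $C_j$ add a vertex $v_j$. If $x_i$ occurs positively in $C_j$, add edge $(v_j,\alpha_{x_i})$ of weight 3; if $C_j$ is the first clause in which $\overline{x_i}$ occurs, add edge $(v_j,\beta_{x_i})$ of weight 1; if $C_j$ is the second clause in which $\overline{x_i}$ occurs, add edge $(v_j,\gamma_{x_i})$ of weight 3. There are no other edges. -}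

module Defs where

open import Data.Nat using (ℕ; zero; suc; _+_; _*_; _≤_; _<ᵇ_)
open import Data.Fin using (Fin; zero; suc; toℕ; #_) renaming (_≟_ to _≟ᶠ_)
open import Data.Bool using (Bool; true; false; _∧_; _∨_; not; if_then_else_)
open import Data.Bool.Properties using () renaming (_≟_ to _≟ᵇ_)
open import Data.List using (List; []; _∷_; _++_; length; map; concatMap; allFin; filterᵇ)
open import Data.Bool.ListAction using (any)
open import Data.Nat.ListAction using (sum)
open import Data.List.Membership.Propositional using (_∈_)
open import Data.Product using (_×_; _,_; proj₁)
open import Data.Sum using (_⊎_)
open import Relation.Nullary.Decidable using (⌊_⌋)
open import Relation.Binary.PropositionalEquality using (_≡_)

-- A literal over variables x_0..x_{n-1}: (i , true) is x_i, (i , false) is ¬x_i.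
Literal : ℕ → Set
Literal n = Fin n × Bool

Clause : ℕ → Set
Clause n = List (Literal n)

-- A CNF formula with m clauses C_0,...,C_{m-1}, in this fixed order.
Formula : ℕ → ℕ → Set
Formula n m = Fin m → Clause n

countᵇ : {A : Set} → (A → Bool) → List A → ℕ
countᵇ p []       = 0
countᵇ p (x ∷ xs) = if p x then suc (countᵇ p xs) else countᵇ p xs

litEqᵇ : {n : ℕ} → Literal n → Literal n → Bool
litEqᵇ (i , b) (i' , b') = ⌊ i ≟ᶠ i' ⌋ ∧ ⌊ b ≟ᵇ b' ⌋

occursᵇ : {n : ℕ} → Literal n → Clause n → Bool
occursᵇ l C = any (litEqᵇ l) C

occ : {n m : ℕ} → Formula n m → Literal n → ℕ
occ {n} {m} φ l = countᵇ (λ j → occursᵇ l (φ j)) (allFin m)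

WellFormed : {n m : ℕ} → Formula n m → Set
WellFormed {n} {m} φ =
  ((j : Fin m) → length (φ j) ≤ 2) ×
  ((i : Fin n) → occ φ (i , true) ≡ 1 × (occ φ (i , false) ≡ 1 ⊎ occ φ (i , false) ≡ 2))

satClauseᵇ : {n : ℕ} → (Fin n → Bool) → Clause n → Bool
satClauseᵇ a C = any (λ l → litEqᵇ (proj₁ l , a (proj₁ l)) l) C

numSat : {n m : ℕ} → Formula n m → (Fin n → Bool) → ℕ
numSat {n} {m} φ a = countᵇ (λ j → satClauseᵇ a (φ j)) (allFin m)

record WEdge (V : Set) : Set where
  constructor wedge
  field
    end₁ : V
    end₂ : V
    wt   : ℕ
open WEdge public

sharesᵇ : {V : Set} → (V → V → Bool) → WEdge V → WEdge V → Bool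
sharesᵇ eq e f = eq (end₁ e) (end₁ f) ∨ eq (end₁ e) (end₂ f) ∨ eq (end₂ e) (end₁ f) ∨ eq (end₂ e) (end₂ f)

removeAdj : {V : Set} → (V → V → Bool) → WEdge V → List (WEdge V) → List (WEdge V)
removeAdj eq e E = filterᵇ (λ f → not (sharesᵇ eq e f)) E

-- GreedyRun eq E M : starting from the current edge set E, the greedy procedure
-- can output the (remaining) matching M.
data GreedyRun {V : Set} (eq : V → V → Bool) : List (WEdge V) → List (WEdge V) → Set where
  done : GreedyRun eq [] []
  pick : {E M : List (WEdge V)} (e : WEdge V) →
         e ∈ E →
         ((f : WEdge V) → f ∈ E → wt f ≤ wt e) →
         GreedyRun eq (removeAdj eq e E) M →
         GreedyRun eq E (e ∷ M)

matchingWeight : {V : Set} → List (WEdge V) → ℕ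
matchingWeight M = sum (map wt M)

-- vertices: var i k is the k-th vertex of the path of x_i, where
-- k = 0..9 stands for β,p,q,r,α,γ,y,z,s,t ; cls j is v_j.
data Vertex (n m : ℕ) : Set where
  var : Fin n → Fin 10 → Vertex n m
  cls : Fin m → Vertex n m

sameVᵇ : {n m : ℕ} → Vertex n m → Vertex n m → Bool
sameVᵇ (var i k) (var i' k') = ⌊ i ≟ᶠ i' ⌋ ∧ ⌊ k ≟ᶠ k' ⌋
sameVᵇ (var _ _) (cls _)     = false
sameVᵇ (cls _)   (var _ _)   = false
sameVᵇ (cls j)   (cls j')    = ⌊ j ≟ᶠ j' ⌋

module _ {n m : ℕ} where
  β p q r α γ y z s t : Fin n → Vertex n m
  β i = var i (# 0)
  p i = var i (# 1)
  q i = var i (# 2)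
  r i = var i (# 3)
  α i = var i (# 4)
  γ i = var i (# 5)
  y i = var i (# 6)
  z i = var i (# 7)
  s i = var i (# 8)
  t i = var i (# 9)

  pathEdges : Fin n → List (WEdge (Vertex n m))
  pathEdges i =
    wedge (β i) (p i) 1 ∷ wedge (p i) (q i) 3 ∷ wedge (q i) (r i) 4 ∷
    wedge (r i) (α i) 4 ∷ wedge (α i) (γ i) 4 ∷ wedge (γ i) (y i) 4 ∷
    wedge (y i) (z i) 4 ∷ wedge (z i) (s i) 3 ∷ wedge (s i) (t i) 1 ∷ []

  negBefore : Formula n m → Fin m → Fin n → ℕ
  negBefore φ j i = countᵇ (λ j' → (toℕ j' <ᵇ toℕ j) ∧ occursᵇ (i , false) (φ j')) (allFin m)

  negEdge : Fin m → Fin n → ℕ → List (WEdge (Vertex n m))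
  negEdge j i zero          = wedge (cls j) (β i) 1 ∷ []   -- C_j is the first clause with ¬x_i
  negEdge j i (suc zero)    = wedge (cls j) (γ i) 3 ∷ []   -- C_j is the second clause with ¬x_i
  negEdge j i (suc (suc _)) = []

  clauseEdges : Formula n m → Fin m → Fin n → List (WEdge (Vertex n m))
  clauseEdges φ j i =
    (if occursᵇ (i , true) (φ j) then wedge (cls j) (α i) 3 ∷ [] else []) ++
    (if occursᵇ (i , false) (φ j) then negEdge j i (negBefore φ j i) else [])

  graphG : Formula n m → List (WEdge (Vertex n m))
  graphG φ = concatMap pathEdges (allFin n) ++
             concatMap (λ j → concatMap (clauseEdges φ j) (allFin n)) (allFin m)

IsGreedyMatching : {n m : ℕ} → Formula n m → List (WEdge (Vertex n m)) → Set
IsGreedyMatching φ M = GreedyRun sameVᵇ (graphG φ) M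

module Submission where

-- The proof is a weak-duality argument.  From M we read off the assignment
-- "x_i is true iff α_i is matched by an edge of weight 3", i.e. to a clause
-- vertex.  We then put a potential on the vertices of G: clause vertex v_j
-- gets 1 if C_j is satisfied and 0 otherwise, and the ten vertices of the
-- path of x_i get one of two fixed tables (chosen by the value of x_i) with
-- total 14.  Every edge of M is covered: its weight is at most the sum of the
-- potentials of its endpoints.  For the two edges where the tables are too
-- small (r–α and v–γ when x_i is true) we show they cannot lie in M: the
-- first because α_i is already matched, the second because the greedy
-- procedure must dominate the weight-4 edge α_i–γ_i by a matching edge of
-- weight at least 4 at α_i or γ_i.  Since the edges of a matching have
-- pairwise distinct endpoints, the weight of M is at most the total
-- potential, which is 14n plus the number of satisfied clauses.

open import Defs
open import Data.Nat using (ℕ; _+_; _*_; _≤_)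
open import Data.Fin using (Fin)
open import Data.Bool using (Bool)
open import Data.List using (List)
open import Data.Product using (∃)

open import Algebra.Properties.CommutativeSemigroup using (x∙yz≈y∙xz)
open import Data.Bool using (true; false; T; T?; not; _∧_; _∨_; if_then_else_)
open import Data.Bool.ListAction using (any)
open import Data.Bool.Properties using (T-∧) renaming (_≟_ to _≟ᵇ_)
open import Data.Empty using (⊥-elim)
open import Data.Fin using (zero; suc; inject₁; #_) renaming (_≟_ to _≟ᶠ_)
open import Data.Fin.Properties using (all?; suc-injective)
open import Data.List using ([]; _∷_; _++_; map; allFin; concatMap; length; lookup)
open import Data.List.Membership.Propositional using (_∈_; find; lose)
open import Data.List.Membership.Propositional.Properties
  using (∈-∃++; ∈-++⁺ˡ; ∈-++⁺ʳ; ∈-++⁻; ∈-map⁺; ∈-map⁻; ∈-concatMap⁺; ∈-concatMap⁻; ∈-filter⁺; ∈-filter⁻; ∈-allFin)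
open import Data.List.Properties using (map-++; map-∘; length-tabulate)
open import Data.List.Relation.Unary.All as All using (All; []; _∷_)
open import Data.List.Relation.Unary.AllPairs using (AllPairs; []; _∷_)
open import Data.List.Relation.Unary.Any using (here; there)
open import Data.List.Relation.Unary.Any.Properties using (any⁺; any⁻)
open import Data.List.Relation.Unary.Unique.Propositional using (Unique)
open import Data.Nat using (z≤n; _≤?_; _≟_) renaming (zero to zeroℕ; suc to sucℕ)
open import Data.Nat.ListAction using (sum)
open import Data.Nat.ListAction.Properties using (sum-++)
open import Data.Nat.Properties
  using (≤-reflexive; +-mono-≤; +-monoʳ-≤; +-cancelˡ-≤; ≤-trans; +-assoc; +-commutativeSemigroup; m≤n+m; *-suc; n≮n; module ≤-Reasoning)
open import Data.Product using (_×_; _,_; proj₁; proj₂)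
open import Data.Sum using (_⊎_; inj₁; inj₂; [_,_]′)
open import Data.Unit using (tt)
open import Function using (_∘_; id; Equivalence)
open import Relation.Nullary using (¬_; yes; no)
open import Relation.Nullary.Decidable using (⌊_⌋; toWitness; fromWitness; _⊎-dec_)
open import Relation.Binary.PropositionalEquality
  using (_≡_; _≢_; refl; sym; trans; cong; cong₂; subst; module ≡-Reasoning)

open Equivalence using (to; from)

indicator : Bool → ℕ
indicator true  = 1
indicator false = 0

indicator-T : ∀ {b} → T b → indicator b ≡ 1
indicator-T {true} _ = refl

T-not⇒¬T : ∀ {b} → T (not b) → ¬ T b
T-not⇒¬T {true} () _

¬T⇒T-not : ∀ {b} → ¬ T b → T (not b)
¬T⇒T-not {true}  ¬b = ¬b tt
¬T⇒T-not {false} _  = tt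

T-∨⁴⁺ : ∀ a b c d → T a ⊎ T b ⊎ T c ⊎ T d → T (a ∨ b ∨ c ∨ d)
T-∨⁴⁺ true  _     _     _ _                          = tt
T-∨⁴⁺ false true  _     _ _                          = tt
T-∨⁴⁺ false false true  _ _                          = tt
T-∨⁴⁺ false false false _ (inj₂ (inj₂ (inj₂ td)))    = td

T-∨⁴⁻ : ∀ a b c d → T (a ∨ b ∨ c ∨ d) → T a ⊎ T b ⊎ T c ⊎ T d
T-∨⁴⁻ true  _     _     _ _  = inj₁ tt
T-∨⁴⁻ false true  _     _ _  = inj₂ (inj₁ tt)
T-∨⁴⁻ false false true  _ _  = inj₂ (inj₂ (inj₁ tt))
T-∨⁴⁻ false false false _ td = inj₂ (inj₂ (inj₂ td))

count-as-sum : {A : Set} (p : A → Bool) (xs : List A) → countᵇ p xs ≡ sum (map (indicator ∘ p) xs)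
count-as-sum p []       = refl
count-as-sum p (x ∷ xs) with p x
... | true  = cong (1 +_) (count-as-sum p xs)
... | false = count-as-sum p xs

sum-map-++ : {A : Set} (f : A → ℕ) (xs ys : List A) → sum (map f (xs ++ ys)) ≡ sum (map f xs) + sum (map f ys)
sum-map-++ f xs ys = trans (cong sum (map-++ f xs ys)) (sum-++ (map f xs) (map f ys))

sum-map-mono : {A : Set} {f g : A → ℕ} (xs : List A) → (∀ {x} → x ∈ xs → f x ≤ g x) → sum (map f xs) ≤ sum (map g xs)
sum-map-mono []       _  = z≤n
sum-map-mono (x ∷ xs) le = +-mono-≤ (le (here refl)) (sum-map-mono xs (le ∘ there))

sum-map-unique-≤ : {A : Set} (f : A → ℕ) {xs ys : List A} → Unique xs → (∀ {x} → x ∈ xs → x ∈ ys) → sum (map f xs) ≤ sum (map f ys)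
sum-map-unique-≤ f {[]}     _               _     = z≤n
sum-map-unique-≤ f {x ∷ xs} (x∉xs ∷ unique) xs⊆ys with ∈-∃++ (xs⊆ys (here refl))
... | pre , post , refl = begin
    f x + sum (map f xs)                        ≤⟨ +-monoʳ-≤ (f x) (sum-map-unique-≤ f unique xs⊆pre++post) ⟩
    f x + sum (map f (pre ++ post))             ≡⟨ cong (f x +_) (sum-map-++ f pre post) ⟩
    f x + (sum (map f pre) + sum (map f post))  ≡⟨ x∙yz≈y∙xz +-commutativeSemigroup (f x) (sum (map f pre)) (sum (map f post)) ⟩
    sum (map f pre) + (f x + sum (map f post))  ≡⟨ sum-map-++ f pre (x ∷ post) ⟨
    sum (map f (pre ++ x ∷ post))               ∎
  where
  open ≤-Reasoning
  xs⊆pre++post : ∀ {y} → y ∈ xs → y ∈ pre ++ post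
  xs⊆pre++post y∈xs with ∈-++⁻ pre (xs⊆ys (there y∈xs))
  ... | inj₁ y∈pre          = ∈-++⁺ˡ y∈pre
  ... | inj₂ (here y≡x)     = ⊥-elim (All.lookup x∉xs y∈xs (sym y≡x))
  ... | inj₂ (there y∈post) = ∈-++⁺ʳ pre y∈post

IsMatching : {V : Set} → (V → V → Bool) → List (WEdge V) → Set
IsMatching eq = AllPairs (λ e f → ¬ T (sharesᵇ eq e f))

module _ {V : Set} (eq : V → V → Bool) where

  greedy-⊆ : ∀ {E M e} → GreedyRun eq E M → e ∈ M → e ∈ E
  greedy-⊆ (pick e e∈E _ _) (here refl) = e∈E
  greedy-⊆ {E} (pick e _ _ run) (there e′∈M) =
    proj₁ (∈-filter⁻ (λ f → T? (not (sharesᵇ eq e f))) {xs = E} (greedy-⊆ run e′∈M))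

  greedy-matching : ∀ {E M} → GreedyRun eq E M → IsMatching eq M
  greedy-matching done = []
  greedy-matching {E} (pick e _ _ run) =
    All.tabulate (λ {f} f∈M → T-not⇒¬T {sharesᵇ eq e f} (proj₂ (∈-filter⁻ (λ f → T? (not (sharesᵇ eq e f))) {xs = E} (greedy-⊆ run f∈M))))
    ∷ greedy-matching run

  greedy-dominates : ∀ {E M f} → GreedyRun eq E M → f ∈ E →
                     ∃ λ e → e ∈ M × T (sharesᵇ eq e f) × wt f ≤ wt e
  greedy-dominates {f = f} (pick e _ heaviest run) f∈E with T? (sharesᵇ eq e f)
  ... | yes e~f = e , here refl , e~f , heaviest f f∈E
  ... | no  e≁f
    with greedy-dominates run (∈-filter⁺ (λ g → T? (not (sharesᵇ eq e g))) f∈E (¬T⇒T-not e≁f))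
  ... | e′ , e′∈M , e′~f , f≤e′ = e′ , there e′∈M , e′~f , f≤e′

module Matchings {V : Set} (eq : V → V → Bool)
                 (eq-sound : ∀ {u v} → T (eq u v) → u ≡ v)
                 (eq-refl : ∀ v → T (eq v v)) where

  data Incident (e : WEdge V) (v : V) : Set where
    at-end₁ : end₁ e ≡ v → Incident e v
    at-end₂ : end₂ e ≡ v → Incident e v

  Loopless : WEdge V → Set
  Loopless e = end₁ e ≢ end₂ e

  private
    same : ∀ {a b v} → a ≡ v → b ≡ v → T (eq a b)
    same refl refl = eq-refl _

  shares-intro : ∀ {e f v} → Incident e v → Incident f v → T (sharesᵇ eq e f)
  shares-intro {e} {f} {v} e∋v f∋v =
    T-∨⁴⁺ (eq (end₁ e) (end₁ f)) (eq (end₁ e) (end₂ f)) (eq (end₂ e) (end₁ f)) (eq (end₂ e) (end₂ f)) (compare e∋v f∋v)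
    where
    compare : Incident e v → Incident f v →
              T (eq (end₁ e) (end₁ f)) ⊎ T (eq (end₁ e) (end₂ f)) ⊎ T (eq (end₂ e) (end₁ f)) ⊎ T (eq (end₂ e) (end₂ f))
    compare (at-end₁ p) (at-end₁ q) = inj₁ (same p q)
    compare (at-end₁ p) (at-end₂ q) = inj₂ (inj₁ (same p q))
    compare (at-end₂ p) (at-end₁ q) = inj₂ (inj₂ (inj₁ (same p q)))
    compare (at-end₂ p) (at-end₂ q) = inj₂ (inj₂ (inj₂ (same p q)))

  shares-elim : ∀ e f → T (sharesᵇ eq e f) → ∃ λ v → Incident e v × Incident f v
  shares-elim e f s with T-∨⁴⁻ (eq (end₁ e) (end₁ f)) (eq (end₁ e) (end₂ f)) (eq (end₂ e) (end₁ f)) (eq (end₂ e) (end₂ f)) s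
  ... | inj₁ t               = end₁ f , at-end₁ (eq-sound t) , at-end₁ refl
  ... | inj₂ (inj₁ t)        = end₂ f , at-end₁ (eq-sound t) , at-end₂ refl
  ... | inj₂ (inj₂ (inj₁ t)) = end₁ f , at-end₂ (eq-sound t) , at-end₁ refl
  ... | inj₂ (inj₂ (inj₂ t)) = end₂ f , at-end₂ (eq-sound t) , at-end₂ refl

  matching-unique : ∀ {M e f v} → IsMatching eq M → e ∈ M → f ∈ M → Incident e v → Incident f v → e ≡ f
  matching-unique (_ ∷ _) (here refl) (here refl) _ _ = refl
  matching-unique (e≁ ∷ _) (here refl) (there f∈M) e∋v f∋v =
    ⊥-elim (All.lookup e≁ f∈M (shares-intro e∋v f∋v))
  matching-unique (f≁ ∷ _) (there e∈M) (here refl) e∋v f∋v =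
    ⊥-elim (All.lookup f≁ e∈M (shares-intro f∋v e∋v))
  matching-unique (_ ∷ matching) (there e∈M) (there f∈M) e∋v f∋v = matching-unique matching e∈M f∈M e∋v f∋v

  endpoints : List (WEdge V) → List V
  endpoints []      = []
  endpoints (e ∷ M) = end₁ e ∷ end₂ e ∷ endpoints M

  endpoint-incident : ∀ {M v} → v ∈ endpoints M → ∃ λ e → e ∈ M × Incident e v
  endpoint-incident {e ∷ M} (here refl)         = e , here refl , at-end₁ refl
  endpoint-incident {e ∷ M} (there (here refl)) = e , here refl , at-end₂ refl
  endpoint-incident {e ∷ M} (there (there v∈)) with endpoint-incident v∈
  ... | f , f∈M , f∋v = f , there f∈M , f∋v

  endpoints-unique : ∀ {M} → IsMatching eq M → All Loopless M → Unique (endpoints M)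
  endpoints-unique {[]} _ _ = []
  endpoints-unique {e ∷ M} (e≁ ∷ matching) (e-loopless ∷ loopless) =
    (e-loopless ∷ fresh (at-end₁ refl)) ∷ fresh (at-end₂ refl) ∷ endpoints-unique matching loopless
    where
    fresh : ∀ {u} → Incident e u → All (u ≢_) (endpoints M)
    fresh e∋u = All.tabulate λ {w} w∈ u≡w →
      let f , f∈M , f∋w = endpoint-incident w∈
      in All.lookup e≁ f∈M (shares-intro e∋u (subst (Incident f) (sym u≡w) f∋w))

  sum-endpoints : (Y : V → ℕ) (M : List (WEdge V)) →
                  sum (map Y (endpoints M)) ≡ sum (map (λ e → Y (end₁ e) + Y (end₂ e)) M)
  sum-endpoints Y []      = refl
  sum-endpoints Y (e ∷ M) = trans (sym (+-assoc (Y (end₁ e)) _ _)) (cong (Y (end₁ e) + Y (end₂ e) +_) (sum-endpoints Y M))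

  potential-bound : (Y : V → ℕ) {M : List (WEdge V)} {Vs : List V} →
                    IsMatching eq M → All Loopless M → (∀ v → v ∈ Vs) →
                    (∀ {e} → e ∈ M → wt e ≤ Y (end₁ e) + Y (end₂ e)) →
                    sum (map wt M) ≤ sum (map Y Vs)
  potential-bound Y {M} {Vs} matching loopless complete covered = begin
    sum (map wt M)                                   ≤⟨ sum-map-mono M covered ⟩
    sum (map (λ e → Y (end₁ e) + Y (end₂ e)) M)      ≡⟨ sum-endpoints Y M ⟨
    sum (map Y (endpoints M))                        ≤⟨ sum-map-unique-≤ Y (endpoints-unique matching loopless) (λ {v} _ → complete v) ⟩
    sum (map Y Vs)                                   ∎
    where open ≤-Reasoning

inject₁≢suc : ∀ {N} (k : Fin N) → inject₁ k ≢ suc k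
inject₁≢suc zero    ()
inject₁≢suc (suc k) p = inject₁≢suc k (suc-injective p)

module _ {n m : ℕ} where

  sameV-sound : ∀ {u v : Vertex n m} → T (sameVᵇ u v) → u ≡ v
  sameV-sound {var i k} {var i′ k′} t =
    let i≡i′ , k≡k′ = to (T-∧ {⌊ i ≟ᶠ i′ ⌋} {⌊ k ≟ᶠ k′ ⌋}) t
    in cong₂ var (toWitness i≡i′) (toWitness k≡k′)
  sameV-sound {cls j} {cls j′} t = cong cls (toWitness t)

  sameV-refl : (v : Vertex n m) → T (sameVᵇ v v)
  sameV-refl (var i k) = from (T-∧ {⌊ i ≟ᶠ i ⌋} {⌊ k ≟ᶠ k ⌋}) (fromWitness {a? = i ≟ᶠ i} refl , fromWitness {a? = k ≟ᶠ k} refl)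
  sameV-refl (cls j)   = fromWitness {a? = j ≟ᶠ j} refl

  sameV-≡ : ∀ {u v : Vertex n m} → u ≡ v → T (sameVᵇ u v)
  sameV-≡ {u} refl = sameV-refl u

  position-injective : ∀ {i i′ k k′} → var {n} {m} i k ≡ var i′ k′ → k ≡ k′
  position-injective refl = refl

  pathVertices : Fin n → List (Vertex n m)
  pathVertices i = map (var i) (allFin 10)

  allVertices : List (Vertex n m)
  allVertices = concatMap pathVertices (allFin n) ++ map cls (allFin m)

  ∈-allVertices : (v : Vertex n m) → v ∈ allVertices
  ∈-allVertices (var i k) = ∈-++⁺ˡ (∈-concatMap⁺ pathVertices (lose (∈-allFin i) (∈-map⁺ (var i) (∈-allFin k))))
  ∈-allVertices (cls j)   = ∈-++⁺ʳ (concatMap pathVertices (allFin n)) (∈-map⁺ cls (∈-allFin j))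

pathWeight : Fin 9 → ℕ
pathWeight = lookup (1 ∷ 3 ∷ 4 ∷ 4 ∷ 4 ∷ 4 ∷ 4 ∷ 3 ∷ 1 ∷ [])

module Graph {n m : ℕ} (φ : Formula n m) where

  open Matchings (sameVᵇ {n} {m}) sameV-sound sameV-refl public

  pathEdge : Fin n → Fin 9 → WEdge (Vertex n m)
  pathEdge i k = wedge (var i (inject₁ k)) (var i (suc k)) (pathWeight k)

  data GEdge : WEdge (Vertex n m) → Set where
    path     : (i : Fin n) (k : Fin 9) → GEdge (pathEdge i k)
    clause-α : (j : Fin m) (i : Fin n) → T (occursᵇ (i , true) (φ j))  → GEdge (wedge (cls j) (α i) 3)
    clause-β : (j : Fin m) (i : Fin n) → T (occursᵇ (i , false) (φ j)) → GEdge (wedge (cls j) (β i) 1)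
    clause-γ : (j : Fin m) (i : Fin n) → T (occursᵇ (i , false) (φ j)) → GEdge (wedge (cls j) (γ i) 3)

  if-∈ : ∀ {e : WEdge (Vertex n m)} b {es} → e ∈ (if b then es else []) → T b × e ∈ es
  if-∈ true e∈ = tt , e∈

  negEdge-kind : ∀ {e} j i c → T (occursᵇ (i , false) (φ j)) → e ∈ negEdge j i c → GEdge e
  negEdge-kind j i zeroℕ        occ (here refl) = clause-β j i occ
  negEdge-kind j i (sucℕ zeroℕ) occ (here refl) = clause-γ j i occ

  classify-clause : ∀ {e} j i → e ∈ clauseEdges φ j i → GEdge e
  classify-clause j i e∈ with ∈-++⁻ (if occursᵇ (i , true) (φ j) then wedge (cls j) (α i) 3 ∷ [] else []) e∈
  ... | inj₁ e∈pos with if-∈ (occursᵇ (i , true) (φ j)) e∈pos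
  ...   | occ , here refl = clause-α j i occ
  classify-clause j i e∈ | inj₂ e∈neg with if-∈ (occursᵇ (i , false) (φ j)) e∈neg
  ... | occ , e∈edge = negEdge-kind j i (negBefore φ j i) occ e∈edge

  -- every edge of G is of one of the four kinds
  -- (pathEdges i computes to map (pathEdge i) (allFin 9))
  classify : ∀ {e} → e ∈ graphG φ → GEdge e
  classify e∈G with ∈-++⁻ (concatMap pathEdges (allFin n)) e∈G
  ... | inj₁ e∈paths with find (∈-concatMap⁻ pathEdges {xs = allFin n} e∈paths)
  ...   | i , _ , e∈path with ∈-map⁻ (pathEdge i) e∈path
  ...     | k , _ , refl = path i k
  classify e∈G | inj₂ e∈clauses
    with find (∈-concatMap⁻ (λ j → concatMap (clauseEdges φ j) (allFin n)) {xs = allFin m} e∈clauses)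
  ... | j , _ , e∈Cj with find (∈-concatMap⁻ (clauseEdges φ j) {xs = allFin n} e∈Cj)
  ...   | i , _ , e∈Cji = classify-clause j i e∈Cji

  pathEdge-∈ : (i : Fin n) (k : Fin 9) → pathEdge i k ∈ graphG φ
  pathEdge-∈ i k = ∈-++⁺ˡ (∈-concatMap⁺ pathEdges (lose (∈-allFin i) (∈-map⁺ (pathEdge i) (∈-allFin k))))

  -- G has no loops, so a matching of G has 2|M| distinct endpoints
  loopless : ∀ {e} → GEdge e → Loopless e
  loopless (path i k) p = inject₁≢suc k (position-injective p)
  loopless (clause-α j i _) ()
  loopless (clause-β j i _) ()
  loopless (clause-γ j i _) ()

litEq-intro : ∀ {n} {i i′ : Fin n} {b b′ : Bool} → i ≡ i′ → b ≡ b′ → T (litEqᵇ (i , b) (i′ , b′))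
litEq-intro {i = i} {b = b} refl refl = from (T-∧ {⌊ i ≟ᶠ i ⌋} {⌊ b ≟ᵇ b ⌋}) (fromWitness {a? = i ≟ᶠ i} refl , fromWitness {a? = b ≟ᵇ b} refl)

litEq-elim : ∀ {n} {i i′ : Fin n} {b b′ : Bool} → T (litEqᵇ (i , b) (i′ , b′)) → i ≡ i′ × b ≡ b′
litEq-elim {i = i} {i′} {b} {b′} t =
  let i≡i′ , b≡b′ = to (T-∧ {⌊ i ≟ᶠ i′ ⌋} {⌊ b ≟ᵇ b′ ⌋}) t in toWitness i≡i′ , toWitness b≡b′

literal-satisfies : ∀ {n} (a : Fin n → Bool) (C : Clause n) {i b} → T (occursᵇ (i , b) C) → a i ≡ b → T (satClauseᵇ a C)
literal-satisfies a C {i} {b} occ ai≡b with find (any⁻ (litEqᵇ (i , b)) C occ)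
... | (i′ , b′) , l∈C , l≡ with litEq-elim {i = i} {i′} {b} {b′} l≡
... | refl , refl = any⁺ (λ l → litEqᵇ (proj₁ l , a (proj₁ l)) l) (lose l∈C (litEq-intro {i = i} refl ai≡b))

-- two tables, for x_i false and x_i true; both sum to 14 and give 2 to α and γ
gadgetPotential : Bool → Fin 10 → ℕ
gadgetPotential false = lookup (0 ∷ 1 ∷ 2 ∷ 2 ∷ 2 ∷ 2 ∷ 2 ∷ 2 ∷ 1 ∷ 0 ∷ [])
gadgetPotential true  = lookup (1 ∷ 0 ∷ 3 ∷ 1 ∷ 2 ∷ 2 ∷ 2 ∷ 2 ∷ 1 ∷ 0 ∷ [])

gadgetPotential-total : ∀ b → sum (map (gadgetPotential b) (allFin 10)) ≡ 14
gadgetPotential-total false = refl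
gadgetPotential-total true  = refl

PathCovered : Bool → Fin 9 → Set
PathCovered b k = pathWeight k ≤ gadgetPotential b (inject₁ k) + gadgetPotential b (suc k)

path-covered : (b : Bool) (k : Fin 9) → (T b → k ≢ # 3) → PathCovered b k
path-covered false k _ =
  toWitness {a? = all? λ k → pathWeight k ≤? gadgetPotential false (inject₁ k) + gadgetPotential false (suc k)} tt k
path-covered true k k≢3 =
  [ ⊥-elim ∘ k≢3 tt , id ]′
    (toWitness {a? = all? λ k → (k ≟ᶠ # 3) ⊎-dec (pathWeight k ≤? gadgetPotential true (inject₁ k) + gadgetPotential true (suc k))} tt k)

module Assignment {n m : ℕ} (φ : Formula n m) (M : List (WEdge (Vertex n m))) (greedy : IsGreedyMatching φ M) where

  open Graph φ

  matching : IsMatching sameVᵇ M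
  matching = greedy-matching sameVᵇ greedy

  edge-of-G : ∀ {e} → e ∈ M → GEdge e
  edge-of-G = classify ∘ greedy-⊆ sameVᵇ greedy

  -- e is an edge at α_i of weight 3; the only such edges of G are clause edges
  clauseEdgeAtα : Fin n → WEdge (Vertex n m) → Bool
  clauseEdgeAtα i e = sameVᵇ (end₂ e) (α i) ∧ ⌊ wt e ≟ 3 ⌋

  assignment : Fin n → Bool
  assignment i = any (clauseEdgeAtα i) M

  satisfied : Fin m → Bool
  satisfied j = satClauseᵇ assignment (φ j)

  assignment-intro : ∀ {e i} → e ∈ M → end₂ e ≡ α i → wt e ≡ 3 → T (assignment i)
  assignment-intro {e} {i} e∈M e∋α w≡3 =
    any⁺ (clauseEdgeAtα i) (lose e∈M (from (T-∧ {sameVᵇ (end₂ e) (α i)} {⌊ wt e ≟ 3 ⌋}) (sameV-≡ e∋α , fromWitness w≡3)))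

  true-α-weight : ∀ {i f} → T (assignment i) → f ∈ M → Incident f (α i) → wt f ≡ 3
  true-α-weight {i} t f∈M f∋α with find (any⁻ (clauseEdgeAtα i) M t)
  ... | e , e∈M , e-at-α =
    let e∋α , w≡3 = to (T-∧ {sameVᵇ (end₂ e) (α i)} {⌊ wt e ≟ 3 ⌋}) e-at-α
    in trans (cong wt (matching-unique matching f∈M e∈M f∋α (at-end₂ (sameV-sound e∋α)))) (toWitness w≡3)

  rα-excluded : ∀ {i k} → pathEdge i k ∈ M → T (assignment i) → k ≢ # 3
  rα-excluded e∈M t refl with true-α-weight t e∈M (at-end₂ refl)
  ... | ()

  -- the edge α_i–γ_i (weight 4) is dominated by a matching edge of weight ≥ 4 at α_i or γ_i;
  -- if x_i is true it is not at α_i, so γ_i is not matched to a clause vertex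
  γ-excluded : ∀ {j i} → wedge (cls j) (γ i) 3 ∈ M → ¬ T (assignment i)
  γ-excluded {i = i} e∈M t with greedy-dominates sameVᵇ greedy (pathEdge-∈ i (# 4))
  ... | f , f∈M , f~αγ , 4≤wf with shares-elim f (pathEdge i (# 4)) f~αγ
  ...   | _ , f∋α , at-end₁ refl = n≮n 3 (subst (4 ≤_) (true-α-weight t f∈M f∋α) 4≤wf)
  ...   | _ , f∋γ , at-end₂ refl =
    n≮n 3 (subst (4 ≤_) (cong wt (matching-unique matching f∈M e∈M f∋γ (at-end₂ refl))) 4≤wf)

  potential : Vertex n m → ℕ
  potential (var i k) = gadgetPotential (assignment i) k
  potential (cls j)   = indicator (satisfied j)

  -- v_j–α_i in M makes x_i true, which satisfies C_j
  α-edge-covered : ∀ {j i} → wedge (cls j) (α i) 3 ∈ M → T (occursᵇ (i , true) (φ j)) →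
                   3 ≤ indicator (satisfied j) + gadgetPotential (assignment i) (# 4)
  -- (the edge itself witnesses that x_i is true, so the case x_i false is absurd)
  α-edge-covered {j} {i} e∈M occ with assignment i in ai | assignment-intro {i = i} e∈M refl refl
  ... | true | _ = ≤-reflexive (sym (cong (_+ 2) (indicator-T (literal-satisfies assignment (φ j) occ ai))))

  -- v_j–β_i: covered by β_i if x_i is true, and by the satisfied clause C_j otherwise
  β-edge-covered : ∀ {j i} → T (occursᵇ (i , false) (φ j)) →
                   1 ≤ indicator (satisfied j) + gadgetPotential (assignment i) (# 0)
  β-edge-covered {j} {i} occ with assignment i in ai
  ... | true  = m≤n+m 1 (indicator (satisfied j))
  ... | false = ≤-reflexive (sym (cong (_+ 0) (indicator-T (literal-satisfies assignment (φ j) occ ai))))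

  -- v_j–γ_i in M forces x_i false, which satisfies C_j
  γ-edge-covered : ∀ {j i} → wedge (cls j) (γ i) 3 ∈ M → T (occursᵇ (i , false) (φ j)) →
                   3 ≤ indicator (satisfied j) + gadgetPotential (assignment i) (# 5)
  γ-edge-covered {j} {i} e∈M occ with assignment i in ai | γ-excluded e∈M
  ... | true  | x-false = ⊥-elim (x-false tt)
  ... | false | _       = ≤-reflexive (sym (cong (_+ 2) (indicator-T (literal-satisfies assignment (φ j) occ ai))))

  covered : ∀ {e} → e ∈ M → wt e ≤ potential (end₁ e) + potential (end₂ e)
  covered e∈M with edge-of-G e∈M
  ... | path i k         = path-covered (assignment i) k (rα-excluded e∈M)
  ... | clause-α j i occ = α-edge-covered e∈M occ
  ... | clause-β j i occ = β-edge-covered occ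
  ... | clause-γ j i occ = γ-edge-covered e∈M occ

  path-potentials : (is : List (Fin n)) → sum (map potential (concatMap pathVertices is)) ≡ 14 * length is
  path-potentials []       = refl
  path-potentials (i ∷ is) = begin
    sum (map potential (pathVertices i ++ concatMap pathVertices is))
      ≡⟨ sum-map-++ potential (pathVertices i) (concatMap pathVertices is) ⟩
    sum (map potential (pathVertices i)) + sum (map potential (concatMap pathVertices is))
      ≡⟨ cong₂ _+_ (gadgetPotential-total (assignment i)) (path-potentials is) ⟩
    14 + 14 * length is
      ≡⟨ *-suc 14 (length is) ⟨
    14 * length (i ∷ is) ∎
    where open ≡-Reasoning

  total-potential : sum (map potential allVertices) ≡ 14 * n + numSat φ assignment
  total-potential = begin
    sum (map potential allVertices)
      ≡⟨ sum-map-++ potential (concatMap pathVertices (allFin n)) (map cls (allFin m)) ⟩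
    sum (map potential (concatMap pathVertices (allFin n))) + sum (map potential (map cls (allFin m)))
      ≡⟨ cong₂ _+_ (path-potentials (allFin n)) (cong sum (sym (map-∘ {g = potential} {f = cls} (allFin m)))) ⟩
    14 * length (allFin n) + sum (map (indicator ∘ satisfied) (allFin m))
      ≡⟨ cong₂ _+_ (cong (14 *_) (length-tabulate {n = n} id)) (sym (count-as-sum satisfied (allFin m))) ⟩
    14 * n + numSat φ assignment ∎
    where open ≡-Reasoning

  weight-bound : matchingWeight M ≤ 14 * n + numSat φ assignment
  weight-bound = begin
    matchingWeight M                 ≤⟨ potential-bound potential matching loopless-M ∈-allVertices covered ⟩
    sum (map potential allVertices)  ≡⟨ total-potential ⟩
    14 * n + numSat φ assignment     ∎
    where
    open ≤-Reasoning
    loopless-M : All Loopless M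
    loopless-M = All.tabulate (loopless ∘ edge-of-G)

lemma3 : (n m : ℕ) (φ : Formula n m) → WellFormed φ →
         (k : ℕ) (M : List (WEdge (Vertex n m))) →
         IsGreedyMatching φ M → 14 * n + k ≤ matchingWeight M →
         ∃ λ (a : Fin n → Bool) → k ≤ numSat φ a
lemma3 n m φ _ k M greedy heavy =
  assignment , +-cancelˡ-≤ (14 * n) k (numSat φ assignment) (≤-trans heavy weight-bound)
  where open Assignment φ M greedy
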